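{- A quadrilateral tiling of a compact connected surface without boundary is (pentagonally) subdivisible if and only if it is possible to assign to every vertex a local orientation (a choice of rotational direction in a small disk neighborhood of the vertex) such that, for every edge, the orientations assigned at its two end vertices are opposite to each other (when compared by transporting one to the other along the edge).
   Context: A tiling of a compact connected surface without boundary is a graph embedded in the surface such that the complementary regions (tiles) are homeomorphic to open disks; tilings are edge-to-edge, every vertex has degree at least $3$, every tile has at least $3$ edges, and tiles may be degenerate (their boundary need not be a simple closed curve, i.e. vertices and edges of a tile may be identified). A quadrilateral tiling is one in which every tile has $4$ edges along its boundary. A simple pentagonal subdivision of a quadrilateral tiling is obtained by placing a new vertex at the middle point of every edge and, inside each quadrilateral tile, joining by an arc the middle points of one of the two pairs of opposite edges of the tile, with the requirement that the middle point of each edge is used exactly once; each quadrilateral is thereby cut into two pentagons. A quadrilateral tiling is (pentagonally) subdivisible if it admits a simple pentagonal subdivision. -}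

module Defs where

-- Combinatorial model: a tiling of a compact connected surface without
-- boundary is encoded as a (finite, connected, boundaryless) generalized map
-- on a finite set of flags (vertex, edge, tile incidence triples).
--   s0 : move to the other vertex   (same edge, same tile)
--   s1 : move to the other edge     (same vertex, same tile)
--   s2 : move to the other tile-side(same vertex, same edge)
-- vertices = <s1,s2>-orbits, edges = <s0,s2>-orbits, tiles = <s0,s1>-orbits.
-- Degenerate tiles (identified vertices/edges) are allowed.

open import Data.Nat using (ℕ; zero; suc)
open import Data.Fin using (Fin)
open import Data.Bool using (Bool; not)
open import Data.Product using (_×_)
open import Relation.Binary.PropositionalEquality using (_≡_; _≢_)

iter : ∀ {A : Set} → ℕ → (A → A) → A → A
iter zero    f x = x
iter (suc k) f x = f (iter k f x)

_∘′_ : ∀ {A : Set} → (A → A) → (A → A) → A → A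
(f ∘′ g) x = f (g x)

record GMap (n : ℕ) : Set where
  field
    s0 s1 s2   : Fin n → Fin n
    s0-invol   : ∀ f → s0 (s0 f) ≡ f
    s1-invol   : ∀ f → s1 (s1 f) ≡ f
    s2-invol   : ∀ f → s2 (s2 f) ≡ f
    -- no boundary: all involutions fixed-point free
    s0-fpf     : ∀ f → s0 f ≢ f
    s1-fpf     : ∀ f → s1 f ≢ f
    s2-fpf     : ∀ f → s2 f ≢ f
    -- s0 s2 is a fixed-point-free involution (surface condition)
    s02-comm   : ∀ f → s0 (s2 f) ≡ s2 (s0 f)
    s02-fpf    : ∀ f → s0 (s2 f) ≢ f

open GMap public

data Reach {n : ℕ} (M : GMap n) : Fin n → Fin n → Set where
  here : ∀ {f} → Reach M f f
  step0 : ∀ {f g} → Reach M (s0 M f) g → Reach M f g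
  step1 : ∀ {f g} → Reach M (s1 M f) g → Reach M f g
  step2 : ∀ {f g} → Reach M (s2 M f) g → Reach M f g

Connected : ∀ {n} → GMap n → Set
Connected {n} M = ∀ (f g : Fin n) → Reach M f g

faceRot : ∀ {n} → GMap n → Fin n → Fin n
faceRot M = s1 M ∘′ s0 M

vertRot : ∀ {n} → GMap n → Fin n → Fin n
vertRot M = s2 M ∘′ s1 M

MinDegree3 : ∀ {n} → GMap n → Set
MinDegree3 {n} M = ∀ (f : Fin n) →
  (iter 1 (vertRot M) f ≢ f) × (iter 2 (vertRot M) f ≢ f)

Quadrilateral : ∀ {n} → GMap n → Set
Quadrilateral {n} M = ∀ (f : Fin n) →
  (iter 4 (faceRot M) f ≡ f) ×
  (iter 1 (faceRot M) f ≢ f) × (iter 2 (faceRot M) f ≢ f) ×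
  (iter 3 (faceRot M) f ≢ f)

record QuadTiling (n : ℕ) : Set where
  field
    gmap      : GMap n
    connected : Connected gmap
    deg≥3     : MinDegree3 gmap
    quad      : Quadrilateral gmap

open QuadTiling public

-- A side of a tile is an <s0>-orbit {f , s0 f}.  In a quadrilateral tile
-- the side opposite to the side of f is the side of s1 (s0 (s1 f)), the
-- adjacent sides are those of s1 f.  The two tile-sides carried by one edge
-- are the sides of f and of s2 f.
--
-- Simple pentagonal subdivision: `chosen f` says that the side of the tile
-- containing f is one of the pair of opposite sides whose midpoints are
-- joined by the arc inside that tile.
record SimplePentagonalSubdivision {n : ℕ} (T : QuadTiling n) : Set where
  private M = gmap T
  field
    chosen          : Fin n → Bool
    side-wd         : ∀ f → chosen (s0 M f) ≡ chosen f
    -- in each tile exactly one of the two pairs of opposite sides is chosen: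
    opposite-same   : ∀ f → chosen (s1 M (s0 M (s1 M f))) ≡ chosen f
    adjacent-differ : ∀ f → chosen (s1 M f) ≡ not (chosen f)
    -- the midpoint of each edge is used exactly once: of the two tile-sides
    -- of an edge exactly one is chosen
    edge-once       : ∀ f → chosen (s2 M f) ≡ not (chosen f)

Subdivisible : ∀ {n} → QuadTiling n → Set
Subdivisible T = SimplePentagonalSubdivision T

-- Local orientation at every vertex: the flags at a vertex split into the
-- two classes of the rotation <s2 s1> (the two rotational directions);
-- `pos f` says that the flag f (as a local frame) is positively oriented
-- with respect to the rotational direction chosen at its vertex.  So `pos`
-- must flip under the reflections s1, s2 at the vertex.
record LocalOrientation {n : ℕ} (T : QuadTiling n) : Set where
  private M = gmap T
  field
    pos      : Fin n → Bool
    flip-s1  : ∀ f → pos (s1 M f) ≡ not (pos f)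
    flip-s2  : ∀ f → pos (s2 M f) ≡ not (pos f)

-- Transporting along the edge of flag f takes the frame f at one end to the
-- frame s0 f at the other end (a reflection); the two local orientations are
-- equal iff pos (s0 f) ≡ not (pos f), and opposite iff pos (s0 f) ≡ pos f.
OppositeAlongEdges : ∀ {n} {T : QuadTiling n} → LocalOrientation T → Set
OppositeAlongEdges {n} {T} o =
  ∀ (f : Fin n) → LocalOrientation.pos o (s0 (gmap T) f) ≡ LocalOrientation.pos o f

{-# OPTIONS --safe #-}
module Submission where

-- A simple pentagonal subdivision and a local orientation that is
-- opposite along every edge are the same labelling of flags, the chosen tile
-- sides being the positively oriented flags.  The only subdivision axiom not
-- shared verbatim, that opposite sides of a tile are chosen together, holds
-- because s0 preserves the labelling while s1 flips it, and s1 is applied twice.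

open import Defs
open import Data.Nat using (ℕ)
open import Data.Bool using (Bool; not)
open import Data.Bool.Properties using (not-involutive)
open import Data.Product using (Σ; _,_)
open import Function.Bundles using (_⇔_; mk⇔)
open import Relation.Binary.PropositionalEquality using (_≡_; cong; module ≡-Reasoning)

conjugate-preserves : ∀ {A : Set} {p : A → Bool} {σ τ : A → A} →
  (∀ x → p (τ x) ≡ not (p x)) → (∀ x → p (σ x) ≡ p x) →
  ∀ x → p (τ (σ (τ x))) ≡ p x
conjugate-preserves {p = p} {σ} {τ} τ-flips σ-preserves x = begin
  p (τ (σ (τ x)))   ≡⟨ τ-flips (σ (τ x)) ⟩
  not (p (σ (τ x))) ≡⟨ cong not (σ-preserves (τ x)) ⟩
  not (p (τ x))     ≡⟨ cong not (τ-flips x) ⟩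
  not (not (p x))   ≡⟨ not-involutive (p x) ⟩
  p x               ∎
  where open ≡-Reasoning

module _ {n : ℕ} {T : QuadTiling n} where

  subdivision⇒oppositeOrientation : Subdivisible T →
    Σ (LocalOrientation T) OppositeAlongEdges
  subdivision⇒oppositeOrientation S =
    record { pos = chosen ; flip-s1 = adjacent-differ ; flip-s2 = edge-once } , side-wd
    where open SimplePentagonalSubdivision S

  oppositeOrientation⇒subdivision : Σ (LocalOrientation T) OppositeAlongEdges →
    Subdivisible T
  oppositeOrientation⇒subdivision (o , opposite) = record
    { chosen          = pos
    ; side-wd         = opposite
    ; opposite-same   = conjugate-preserves flip-s1 opposite
    ; adjacent-differ = flip-s1
    ; edge-once       = flip-s2
    }
    where open LocalOrientation o

proposition2p2 : ∀ (n : ℕ) (T : QuadTiling n) →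
    Subdivisible T ⇔ Σ (LocalOrientation T) (λ o → OppositeAlongEdges o)
proposition2p2 n T =
  mk⇔ subdivision⇒oppositeOrientation oppositeOrientation⇒subdivision
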